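{- Let $G$ be an abelian group and $U,V\in\mathcal F(G\setminus\{0\})$. Suppose that either $U,V\in\mathcal A(G)$, or $U$ and $V$ are zero-sum free with $\sigma(UV)=0$. Then $\max\mathsf L(UV)\le\min\{|U|,|V|\}$. Moreover, if $\max\mathsf L(UV)=|U|\ge3$, then $-\operatorname{supp}(U)\subset\Sigma(V)$.
   Context: $\mathcal F(G_0)$ is the free abelian monoid on $G_0$; its elements (sequences) are written $S=g_1\cdots g_l$, with length $|S|=l$, support $\operatorname{supp}(S)$ (set of terms), sum $\sigma(S)=\sum g_i$, and set of subsums $\Sigma(S)=\{\sum_{i\in I}g_i:\emptyset\ne I\subset[1,l]\}$. $S$ is zero-sum free if $0\notin\Sigma(S)$. $\mathcal B(G)=\{S\in\mathcal F(G):\sigma(S)=0\}$, and $\mathcal A(G)$ is its set of atoms, the minimal zero-sum sequences (nonempty zero-sum sequences with no proper nonempty zero-sum subsequence). For $S\in\mathcal B(G)$, $\mathsf L(S)$ is the set of $k$ such that $S$ is a product of $k$ elements of $\mathcal A(G)$. $-\operatorname{supp}(U)=\{ -g:g\in\operatorname{supp}(U)\}$. -}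

module Defs where

open import Level using (Level; _⊔_)
open import Algebra.Bundles using (AbelianGroup)
open import Data.Nat using (ℕ; _≤_)
open import Data.List using (List; []; _∷_; _++_; foldr; length; concat)
open import Data.List.Relation.Unary.All using (All)
open import Data.List.Membership.Propositional using (_∈_)
open import Data.List.Relation.Binary.Sublist.Propositional using (_⊆_)
import Data.List.Relation.Binary.Permutation.Setoid as PermSetoid
open import Data.Product using (Σ; _×_; ∃)
open import Relation.Binary.PropositionalEquality using (_≡_)
open import Relation.Nullary using (¬_)

-- Sequences over G are finite lists; the free abelian monoid F(G) is lists
-- up to permutation (modulo the group's equality ≈).
module Sequences {c ℓ : Level} (G : AbelianGroup c ℓ) where
  open AbelianGroup G renaming (Carrier to A)
  open PermSetoid setoid using (_↭_)

  Seq : Set c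
  Seq = List A

  σ : Seq → A
  σ = foldr _∙_ ε

  NonEmpty : Seq → Set c
  NonEmpty S = ¬ (S ≡ [])

  NonZeroTerms : Seq → Set (c ⊔ ℓ)
  NonZeroTerms S = All (λ g → ¬ (g ≈ ε)) S

  -- g ∈ Σ(S): g is the sum of a nonempty subsequence of S
  -- (subsequences = sub-lists, i.e. sub-multisets given by index sets)
  _∈Σ_ : A → Seq → Set (c ⊔ ℓ)
  g ∈Σ S = Σ Seq (λ T → (T ⊆ S) × NonEmpty T × (σ T ≈ g))

  ZeroSumFree : Seq → Set (c ⊔ ℓ)
  ZeroSumFree S = ¬ (ε ∈Σ S)

  ZeroSum : Seq → Set ℓ
  ZeroSum S = σ S ≈ ε

  Atom : Seq → Set (c ⊔ ℓ)
  Atom S = NonEmpty S × ZeroSum S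
         × (∀ (T : Seq) → T ⊆ S → NonEmpty T → σ T ≈ ε → length T ≡ length S)

  _∈L_ : ℕ → Seq → Set (c ⊔ ℓ)
  k ∈L S = Σ (List Seq) (λ As → (length As ≡ k) × All Atom As × (concat As ↭ S))

  IsMaxL : ℕ → Seq → Set (c ⊔ ℓ)
  IsMaxL k S = (k ∈L S) × (∀ j → j ∈L S → j ≤ k)

module Submission where

-- Let U V = A₁ ⋯ A_k be a factorization into atoms.  Since U V is the
-- product of U and V, every atom splits as A_i = X_i Y_i with X_i a
-- submultiset of U and Y_i a submultiset of V, and the X_i (resp. Y_i)
-- together make up U (resp. V).  Call a piece mixed if both X_i and Y_i are
-- nonempty.
--   * If U, V are zero-sum free, every piece is mixed (a piece inside U or V
--     would be a zero-sum subsequence).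
--   * If U, V are atoms, a piece lying inside U is all of U, one inside V is
--     all of V; a counting argument shows that then k ≤ 2 ≤ |U|, |V|.
-- When all pieces are mixed, k ≤ Σ|X_i| = |U| and k ≤ Σ|Y_i| = |V|.  If
-- moreover k = |U| ≥ 3, every X_i is a single term x, and x + σ(Y_i) = 0
-- puts -x into Σ(V).

open import Defs
open import Level using (Level)
open import Algebra.Bundles using (AbelianGroup)
open import Data.Nat using (_≤_)
open import Data.List using (_++_; length)
open import Data.List.Membership.Propositional using (_∈_)
open import Data.Product using (_×_)
open import Data.Sum using (_⊎_)

open import Function using (_∘_)
open import Data.Nat using (ℕ; zero; suc; _+_; _*_; z≤n; s≤s)
open import Data.Nat.Base using (>-nonZero)
open import Data.Nat.Properties
open import Algebra.Properties.CommutativeSemigroup +-commutativeSemigroup using (x∙yz≈y∙xz)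
open import Data.List using (List; []; _∷_; concat; map)
open import Data.Nat.ListAction using (sum)
import Data.List.Properties as List
open import Data.List.Relation.Unary.All as All using (All; []; _∷_)
open import Data.List.Relation.Unary.Any as Any using (Any; here; there)
open import Data.List.Relation.Binary.Sublist.Propositional using (_⊆_; []; _∷_; _∷ʳ_)
open import Data.Product using (∃; _,_; proj₁; proj₂)
open import Data.Sum as Sum using (inj₁; inj₂)
open import Data.Empty using (⊥-elim)
open import Relation.Binary.PropositionalEquality as Eq using (_≡_; refl; cong; subst)
import Data.List.Relation.Binary.Permutation.Setoid as Permutation
import Data.List.Relation.Binary.Permutation.Setoid.Properties as PermutationProperties
import Data.List.Membership.Setoid as Membership
import Data.List.Membership.Setoid.Properties as MembershipProperties
import Algebra.Properties.Group as GroupProperties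

∑ : ∀ {b} {B : Set b} → (B → ℕ) → List B → ℕ
∑ f xs = sum (map f xs)

length≤∑ : ∀ {b} {B : Set b} (f : B → ℕ) xs → All (λ x → 1 ≤ f x) xs → length xs ≤ ∑ f xs
length≤∑ f []       []         = z≤n
length≤∑ f (x ∷ xs) (fx≥1 ∷ ps) = +-mono-≤ fx≥1 (length≤∑ f xs ps)

length≡∑⇒all1 : ∀ {b} {B : Set b} (f : B → ℕ) xs → All (λ x → 1 ≤ f x) xs
              → length xs ≡ ∑ f xs → All (λ x → f x ≡ 1) xs
length≡∑⇒all1 f []       []          _  = []
length≡∑⇒all1 f (x ∷ xs) (fx≥1 ∷ ps) eq = fx≡1 ∷ length≡∑⇒all1 f xs ps rest
  where
  fx≤1 : f x ≤ 1
  fx≤1 = +-cancelʳ-≤ (∑ f xs) (f x) 1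
           (subst (_≤ 1 + ∑ f xs) eq (s≤s (length≤∑ f xs ps)))
  fx≡1 : f x ≡ 1
  fx≡1 = ≤-antisym fx≤1 fx≥1
  rest : length xs ≡ ∑ f xs
  rest = suc-injective (Eq.trans eq (cong (_+ ∑ f xs) fx≡1))

p*u≤u⇒p≤1 : ∀ {u} m p → 1 ≤ u → m + p * u ≤ u → p ≤ 1
p*u≤u⇒p≤1 {u} m p u≥1 le =
  *-cancelʳ-≤ p 1 u {{>-nonZero u≥1}}
    (subst (p * u ≤_) (Eq.sym (*-identityˡ u)) (≤-trans (m≤n+m (p * u) m) le))

p≥1⇒m≡0 : ∀ {u} m p → m + suc p * u ≤ u → m ≡ 0
p≥1⇒m≡0 {u} m p le =
  n≤0⇒n≡0 (+-cancelʳ-≤ u m 0 (≤-trans (+-monoʳ-≤ m (m≤m+n u (p * u))) le))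

atMostTwo : ∀ m p q → m ≡ 0 → p ≤ 1 → q ≤ 1 → m + p + q ≤ 2
atMostTwo _ _ _ refl = +-mono-≤

-- m mixed pieces together with p copies of u and q copies of v fit into u
-- and v only if there are no copies at all, or at most two pieces in total.
noneOrFew : ∀ {u v} m p q → 1 ≤ u → 1 ≤ v → m + p * u ≤ u → m + q * v ≤ v
          → p + q ≡ 0 ⊎ m + p + q ≤ 2
noneOrFew m zero    zero    _   _   _ _ = inj₁ refl
noneOrFew m (suc p) q       u≥1 v≥1 l r =
  inj₂ (atMostTwo m (suc p) q (p≥1⇒m≡0 m p l) (p*u≤u⇒p≤1 m (suc p) u≥1 l) (p*u≤u⇒p≤1 m q v≥1 r))
noneOrFew m zero    (suc q) u≥1 v≥1 l r =
  inj₂ (atMostTwo m 0 (suc q) (p≥1⇒m≡0 m q r) z≤n (p*u≤u⇒p≤1 m (suc q) v≥1 r))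

-- Elements of B carry a left and a right weight (for us: the number of
-- terms a piece takes from U and from V).
module Counting {b} {B : Set b} (left right : B → ℕ) where

  Mixed : B → Set
  Mixed x = 1 ≤ left x × 1 ≤ right x

  data Kind (u v : ℕ) (x : B) : Set where
    mixed      : Mixed x → Kind u v x
    leftHeavy  : u ≤ left x → Kind u v x
    rightHeavy : v ≤ right x → Kind u v x

  census : ∀ {u v} xs → All (Kind u v) xs →
    ∃ λ m → ∃ λ p → ∃ λ q → (length xs ≡ m + p + q)
      × (m + p * u ≤ ∑ left xs) × (m + q * v ≤ ∑ right xs)
      × (p + q ≡ 0 → All Mixed xs)
  census [] [] = 0 , 0 , 0 , refl , z≤n , z≤n , λ _ → []
  census {u} {v} (x ∷ xs) (k ∷ ks) with census xs ks
  ... | m , p , q , len , l , r , onlyMixed with k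
  ... | mixed mx@(lx≥1 , rx≥1) =
    suc m , p , q , cong suc len , +-mono-≤ lx≥1 l , +-mono-≤ rx≥1 r ,
    λ none → mx ∷ onlyMixed none
  ... | leftHeavy u≤lx =
    m , suc p , q , Eq.trans (cong suc len) (cong (_+ q) (Eq.sym (+-suc m p))) ,
    ≤-trans (≤-reflexive (x∙yz≈y∙xz m u (p * u))) (+-mono-≤ u≤lx l) ,
    ≤-trans r (m≤n+m _ (right x)) , λ ()
  ... | rightHeavy v≤rx =
    m , p , suc q , Eq.trans (cong suc len) (Eq.sym (+-suc (m + p) q)) ,
    ≤-trans l (m≤n+m _ (left x)) ,
    ≤-trans (≤-reflexive (x∙yz≈y∙xz m v (q * v))) (+-mono-≤ v≤rx r) ,
    λ none → ⊥-elim (1+n≢0 (Eq.trans (Eq.sym (+-suc p q)) none))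

  mixedOrFew : ∀ {u v} xs → 1 ≤ u → 1 ≤ v → All (Kind u v) xs
             → ∑ left xs ≤ u → ∑ right xs ≤ v → All Mixed xs ⊎ length xs ≤ 2
  mixedOrFew xs u≥1 v≥1 ks ≤u ≤v with census xs ks
  ... | m , p , q , len , l , r , onlyMixed
      with noneOrFew m p q u≥1 v≥1 (≤-trans l ≤u) (≤-trans r ≤v)
  ... | inj₁ none = inj₁ (onlyMixed none)
  ... | inj₂ few  = inj₂ (subst (_≤ 2) (Eq.sym len) few)

module Pieces {c ℓ : Level} (G : AbelianGroup c ℓ) where
  open AbelianGroup G renaming (refl to ≈-refl; sym to ≈-sym; trans to ≈-trans)
  open Sequences G
  open Permutation setoid using (_↭_; prep; ↭-refl; ↭-sym; ↭-trans; ↭-prep; ↭-reflexive; ↭-reflexive-≋)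
  open PermutationProperties setoid
    using (foldr-commMonoid; ∈-resp-↭; ↭-shift; drop-∷; ++⁺ʳ; ++⁺ˡ; ++-comm; xs↭ys⇒|xs|≡|ys|; ¬x∷xs↭[])
  open Membership setoid using () renaming (_∈_ to _∈ₛ_)
  open MembershipProperties using (∈-∃++; ∈-++⁻)
  open GroupProperties group using (inverseʳ-unique)

  σ-↭ : ∀ {X Y} → X ↭ Y → σ X ≈ σ Y
  σ-↭ = foldr-commMonoid isCommutativeMonoid

  _⊑_ : Seq → Seq → Set (c Level.⊔ ℓ)
  X ⊑ U = ∃ λ Z → X ++ Z ↭ U

  ⊑-trans : ∀ {X Y U} → X ⊑ Y → Y ⊑ U → X ⊑ U
  ⊑-trans {X} (Z , XZ↭Y) (Z′ , YZ′↭U) =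
    Z ++ Z′ , ↭-trans (↭-reflexive (Eq.sym (List.++-assoc X Z Z′))) (↭-trans (++⁺ʳ Z′ XZ↭Y) YZ′↭U)

  ∈⇒↭∷ : ∀ {v U} → v ∈ₛ U → ∃ λ U′ → U ↭ v ∷ U′
  ∈⇒↭∷ v∈U with ∈-∃++ setoid v∈U
  ... | ys , zs , w , v≈w , U≋ =
    ys ++ zs , ↭-trans (↭-reflexive-≋ U≋) (↭-trans (↭-shift ys zs) (prep (≈-sym v≈w) ↭-refl))

  ↭-++-split : ∀ P Q U V → P ++ Q ↭ U ++ V →
    ∃ λ X₁ → ∃ λ Y₁ → ∃ λ X₂ → ∃ λ Y₂ →
      (P ↭ X₁ ++ Y₁) × (Q ↭ X₂ ++ Y₂) × (X₁ ++ X₂ ↭ U) × (Y₁ ++ Y₂ ↭ V)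
  ↭-++-split [] Q U V QUV = [] , [] , U , V , ↭-refl , QUV , ↭-refl , ↭-refl
  ↭-++-split (p ∷ P) Q U V pPQ↭UV with ∈-++⁻ setoid U (∈-resp-↭ pPQ↭UV (here ≈-refl))
  ... | inj₁ p∈U with ∈⇒↭∷ p∈U
  ...   | U′ , U↭pU′ with ↭-++-split P Q U′ V (drop-∷ (↭-trans pPQ↭UV (++⁺ʳ V U↭pU′)))
  ...     | X₁ , Y₁ , X₂ , Y₂ , P↭ , Q↭ , X↭U′ , Y↭V =
    p ∷ X₁ , Y₁ , X₂ , Y₂ , ↭-prep p P↭ , Q↭ , ↭-trans (↭-prep p X↭U′) (↭-sym U↭pU′) , Y↭V
  ↭-++-split (p ∷ P) Q U V pPQ↭UV | inj₂ p∈V with ∈⇒↭∷ p∈V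
  ...   | V′ , V↭pV′ with ↭-++-split P Q U V′
                          (drop-∷ (↭-trans pPQ↭UV (↭-trans (++⁺ˡ U V↭pV′) (↭-shift U V′))))
  ...     | X₁ , Y₁ , X₂ , Y₂ , P↭ , Q↭ , X↭U , Y↭V′ =
    X₁ , p ∷ Y₁ , X₂ , Y₂ , ↭-trans (↭-prep p P↭) (↭-sym (↭-shift X₁ Y₁)) , Q↭ , X↭U ,
    ↭-trans (↭-prep p Y↭V′) (↭-sym V↭pV′)

  ⊑⇒⊆ : ∀ X Z U → X ++ Z ↭ U → ∃ λ T → (T ⊆ U) × (T ↭ X)
  ⊑⇒⊆ []      Z [] _    = [] , [] , ↭-refl
  ⊑⇒⊆ (x ∷ X) Z [] xXZ↭ = ⊥-elim (¬x∷xs↭[] xXZ↭)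
  ⊑⇒⊆ X Z (u ∷ U) XZ↭uU with ∈-++⁻ setoid X (∈-resp-↭ (↭-sym XZ↭uU) (here ≈-refl))
  ... | inj₁ u∈X with ∈⇒↭∷ u∈X
  ...   | X′ , X↭uX′ with ⊑⇒⊆ X′ Z U (drop-∷ (↭-trans (↭-sym (++⁺ʳ Z X↭uX′)) XZ↭uU))
  ...     | T , T⊆U , T↭X′ = u ∷ T , refl ∷ T⊆U , ↭-trans (↭-prep u T↭X′) (↭-sym X↭uX′)
  ⊑⇒⊆ X Z (u ∷ U) XZ↭uU | inj₂ u∈Z with ∈⇒↭∷ u∈Z
  ...   | Z′ , Z↭uZ′ with ⊑⇒⊆ X Z′ U
                          (drop-∷ (↭-trans (↭-sym (↭-trans (++⁺ˡ X Z↭uZ′) (↭-shift X Z′))) XZ↭uU))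
  ...     | T , T⊆U , T↭X = T , u ∷ʳ T⊆U , T↭X

  nonEmpty-length : ∀ {T X : Seq} → length T ≡ length X → NonEmpty X → NonEmpty T
  nonEmpty-length {[]} {[]}    _  X≢[] = λ _ → X≢[] refl
  nonEmpty-length {[]} {_ ∷ _} ()
  nonEmpty-length {_ ∷ _}      _  _    = λ ()

  ⊑-∈Σ : ∀ {X U g} → X ⊑ U → NonEmpty X → σ X ≈ g → g ∈Σ U
  ⊑-∈Σ {X} {U} (Z , XZ↭U) X≢[] σX≈g with ⊑⇒⊆ X Z U XZ↭U
  ... | T , T⊆U , T↭X =
    T , T⊆U , nonEmpty-length (xs↭ys⇒|xs|≡|ys| T↭X) X≢[] , ≈-trans (σ-↭ T↭X) σX≈g

  ⊑-atom : ∀ {X U} → Atom U → X ⊑ U → NonEmpty X → σ X ≈ ε → length X ≡ length U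
  ⊑-atom {X} {U} (_ , _ , minimal) (Z , XZ↭U) X≢[] σX≈ε with ⊑⇒⊆ X Z U XZ↭U
  ... | T , T⊆U , T↭X =
    Eq.trans (Eq.sym (xs↭ys⇒|xs|≡|ys| T↭X))
      (minimal T T⊆U (nonEmpty-length (xs↭ys⇒|xs|≡|ys| T↭X) X≢[]) (≈-trans (σ-↭ T↭X) σX≈ε))

  atom-length≥2 : ∀ {U} → NonZeroTerms U → Atom U → 2 ≤ length U
  atom-length≥2 {[]}        _            (U≢[] , _) = ⊥-elim (U≢[] refl)
  atom-length≥2 {x ∷ []}    (x≉ε ∷ [])   (_ , σ≈ε , _) = ⊥-elim (x≉ε (≈-trans (≈-sym (identityʳ x)) σ≈ε))
  atom-length≥2 {_ ∷ _ ∷ _} _            _ = s≤s (s≤s z≤n)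

  -- A nonempty zero-sum sequence; minimality of the atoms is only used for
  -- U and V themselves, not for the factors of U V.
  ZeroSumBlock : Seq → Set (c Level.⊔ ℓ)
  ZeroSumBlock W = NonEmpty W × σ W ≈ ε

  block-↭ : ∀ {W Z} → W ↭ Z → ZeroSumBlock W → ZeroSumBlock Z
  block-↭ W↭Z (W≢[] , σW≈ε) =
    nonEmpty-length (Eq.sym (xs↭ys⇒|xs|≡|ys| W↭Z)) W≢[] , ≈-trans (≈-sym (σ-↭ W↭Z)) σW≈ε

  AtomsOrZeroSumFree : Seq → Seq → Set (c Level.⊔ ℓ)
  AtomsOrZeroSumFree U V = ((Atom U × Atom V) ⊎ (ZeroSumFree U × ZeroSumFree V × ZeroSum (U ++ V)))

  Piece : Seq → Seq → Seq × Seq → Set (c Level.⊔ ℓ)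
  Piece U V (X , Y) = X ⊑ U × Y ⊑ V × ZeroSumBlock (X ++ Y)

  open Counting {B = Seq × Seq} (length ∘ proj₁) (length ∘ proj₂) public

  record Splitting (Ws : List Seq) (U V : Seq) : Set (c Level.⊔ ℓ) where
    field
      pieces : List (Seq × Seq)
      count  : length pieces ≡ length Ws
      fromU  : ∑ (length ∘ proj₁) pieces ≡ length U
      fromV  : ∑ (length ∘ proj₂) pieces ≡ length V
      covers : ∀ {g} → g ∈ₛ U → Any (λ XY → g ∈ₛ proj₁ XY) pieces
      valid  : All (Piece U V) pieces

  split : ∀ Ws U V → All ZeroSumBlock Ws → concat Ws ↭ U ++ V → Splitting Ws U V
  split [] [] [] _ _ = record
    { pieces = [] ; count = refl ; fromU = refl ; fromV = refl ; covers = λ () ; valid = [] }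
  split [] (u ∷ U) V _ []↭ = ⊥-elim (¬x∷xs↭[] (↭-sym []↭))
  split [] [] (v ∷ V) _ []↭ = ⊥-elim (¬x∷xs↭[] (↭-sym []↭))
  split (W ∷ Ws) U V (block ∷ blocks) WWs↭UV
    with ↭-++-split W (concat Ws) U V WWs↭UV
  ... | X₁ , Y₁ , X₂ , Y₂ , W↭ , Ws↭ , X↭U , Y↭V = record
    { pieces = (X₁ , Y₁) ∷ pieces
    ; count  = cong suc count
    ; fromU  = Eq.trans (cong (length X₁ +_) fromU)
                 (Eq.trans (Eq.sym (List.length-++ X₁)) (xs↭ys⇒|xs|≡|ys| X↭U))
    ; fromV  = Eq.trans (cong (length Y₁ +_) fromV)
                 (Eq.trans (Eq.sym (List.length-++ Y₁)) (xs↭ys⇒|xs|≡|ys| Y↭V))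
    ; covers = covers′
    ; valid  = ((X₂ , X↭U) , (Y₂ , Y↭V) , block-↭ W↭ block) ∷ All.map enlarge valid
    }
    where
    open Splitting (split Ws X₂ Y₂ blocks Ws↭)
    covers′ : ∀ {g} → g ∈ₛ U → Any (λ XY → g ∈ₛ proj₁ XY) ((X₁ , Y₁) ∷ pieces)
    covers′ g∈U with ∈-++⁻ setoid X₁ (∈-resp-↭ (↭-sym X↭U) g∈U)
    ... | inj₁ g∈X₁ = here g∈X₁
    ... | inj₂ g∈X₂ = there (covers g∈X₂)
    enlarge : ∀ {XY} → Piece X₂ Y₂ XY → Piece U V XY
    enlarge (X⊑X₂ , Y⊑Y₂ , zeroSum) =
      ⊑-trans X⊑X₂ (X₁ , ↭-trans (++-comm X₂ X₁) X↭U) ,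
      ⊑-trans Y⊑Y₂ (Y₁ , ↭-trans (++-comm Y₂ Y₁) Y↭V) , zeroSum

  zeroSumFree⇒mixed : ∀ {U V} → ZeroSumFree U → ZeroSumFree V → ∀ {XY} → Piece U V XY → Mixed XY
  zeroSumFree⇒mixed zfU zfV {[] , Y} (_ , Y⊑V , Y≢[] , σY≈ε) = ⊥-elim (zfV (⊑-∈Σ Y⊑V Y≢[] σY≈ε))
  zeroSumFree⇒mixed zfU zfV {x ∷ X , []} (X⊑U , _ , zeroSum)
    with subst ZeroSumBlock (List.++-identityʳ (x ∷ X)) zeroSum
  ... | X≢[] , σX≈ε = ⊥-elim (zfU (⊑-∈Σ X⊑U X≢[] σX≈ε))
  zeroSumFree⇒mixed zfU zfV {_ ∷ _ , _ ∷ _} _ = s≤s z≤n , s≤s z≤n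

  atoms⇒kind : ∀ {U V} → Atom U → Atom V → ∀ {XY} → Piece U V XY → Kind (length U) (length V) XY
  atoms⇒kind atU atV {[] , Y} (_ , Y⊑V , Y≢[] , σY≈ε) =
    rightHeavy (≤-reflexive (Eq.sym (⊑-atom atV Y⊑V Y≢[] σY≈ε)))
  atoms⇒kind atU atV {x ∷ X , []} (X⊑U , _ , zeroSum)
    with subst ZeroSumBlock (List.++-identityʳ (x ∷ X)) zeroSum
  ... | X≢[] , σX≈ε = leftHeavy (≤-reflexive (Eq.sym (⊑-atom atU X⊑U X≢[] σX≈ε)))
  atoms⇒kind atU atV {_ ∷ _ , _ ∷ _} _ = mixed (s≤s z≤n , s≤s z≤n)

  mixedOrShort : ∀ {Ws U V} → NonZeroTerms U → NonZeroTerms V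
    → AtomsOrZeroSumFree U V
    → (S : Splitting Ws U V) → let open Splitting S in
      All Mixed pieces ⊎ (length pieces ≤ 2 × 2 ≤ length U × 2 ≤ length V)
  mixedOrShort _ _ (inj₂ (zfU , zfV , _)) S =
    inj₁ (All.map (zeroSumFree⇒mixed zfU zfV) (Splitting.valid S))
  mixedOrShort {U = U} {V} nzU nzV (inj₁ (atU , atV)) S =
    Sum.map₂ (λ few → few , U≥2 , V≥2)
      (mixedOrFew pieces (≤-trans (s≤s z≤n) U≥2) (≤-trans (s≤s z≤n) V≥2)
        (All.map (atoms⇒kind atU atV) valid) (≤-reflexive fromU) (≤-reflexive fromV))
    where
    open Splitting S
    U≥2 : 2 ≤ length U
    U≥2 = atom-length≥2 nzU atU
    V≥2 : 2 ≤ length V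
    V≥2 = atom-length≥2 nzV atV

  positive-length : ∀ {T : Seq} → 1 ≤ length T → NonEmpty T
  positive-length {_ ∷ _} _ = λ ()

  singleton⇒inverse∈Σ : ∀ {U V X Y g} → Piece U V (X , Y) → Mixed (X , Y)
    → length X ≡ 1 → g ∈ₛ X → (g ⁻¹) ∈Σ V
  singleton⇒inverse∈Σ {X = x ∷ []} {Y} (_ , Y⊑V , _ , x+σY≈ε) (_ , Y≥1) _ (here g≈x) =
    ⊑-∈Σ Y⊑V (positive-length Y≥1)
      (≈-trans (inverseʳ-unique x (σ Y) x+σY≈ε) (⁻¹-cong (≈-sym g≈x)))
  singleton⇒inverse∈Σ {X = _ ∷ []} _ _ _ (there ())

  splitting-length≤ : ∀ {Ws U V} → NonZeroTerms U → NonZeroTerms V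
    → AtomsOrZeroSumFree U V
    → Splitting Ws U V → length Ws ≤ length U × length Ws ≤ length V
  splitting-length≤ {U = U} {V} nzU nzV hyp S =
    subst (λ n → n ≤ length U × n ≤ length V) count (bound (mixedOrShort nzU nzV hyp S))
    where
    open Splitting S
    bound : All Mixed pieces ⊎ (length pieces ≤ 2 × 2 ≤ length U × 2 ≤ length V)
          → length pieces ≤ length U × length pieces ≤ length V
    bound (inj₁ allMixed) =
      ≤-trans (length≤∑ _ pieces (All.map proj₁ allMixed)) (≤-reflexive fromU) ,
      ≤-trans (length≤∑ _ pieces (All.map proj₂ allMixed)) (≤-reflexive fromV)
    bound (inj₂ (few , U≥2 , V≥2)) = ≤-trans few U≥2 , ≤-trans few V≥2

  splitting-inverses : ∀ {Ws U V g} → NonZeroTerms U → NonZeroTerms V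
    → AtomsOrZeroSumFree U V
    → Splitting Ws U V → length Ws ≡ length U → 3 ≤ length U → g ∈ₛ U → (g ⁻¹) ∈Σ V
  splitting-inverses {U = U} nzU nzV hyp S |Ws|≡|U| U≥3 g∈U =
    let (piece , mixedXY , |X|≡1) , g∈X =
          All.lookupAny (All.zip (valid , All.zip (allMixed , singletons))) (covers g∈U)
    in singleton⇒inverse∈Σ piece mixedXY |X|≡1 g∈X
    where
    open Splitting S
    |pieces|≡|U| : length pieces ≡ length U
    |pieces|≡|U| = Eq.trans count |Ws|≡|U|
    allMixed : All Mixed pieces
    allMixed with mixedOrShort nzU nzV hyp S
    ... | inj₁ allMixed = allMixed
    ... | inj₂ (few , _) = ⊥-elim (<⇒≱ U≥3 (subst (_≤ 2) |pieces|≡|U| few))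
    singletons : All (λ XY → length (proj₁ XY) ≡ 1) pieces
    singletons = length≡∑⇒all1 _ pieces (All.map proj₁ allMixed)
                   (Eq.trans |pieces|≡|U| (Eq.sym fromU))

  atoms⇒blocks : ∀ {As} → All Atom As → All ZeroSumBlock As
  atoms⇒blocks = All.map (λ (A≢[] , σA≈ε , _) → A≢[] , σA≈ε)

lemma5p1 : ∀ {c ℓ : Level} (G : AbelianGroup c ℓ)
    → let open AbelianGroup G using (_⁻¹)
          open Sequences G in
      (U V : Seq) → NonZeroTerms U → NonZeroTerms V
    → ((Atom U × Atom V) ⊎ (ZeroSumFree U × ZeroSumFree V × ZeroSum (U ++ V)))
    → ((∀ k → k ∈L (U ++ V) → (k ≤ length U × k ≤ length V))
      × (IsMaxL (length U) (U ++ V) → 3 ≤ length U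
          → ∀ g → g ∈ U → (g ⁻¹) ∈Σ V))
lemma5p1 G U V nzU nzV hyp = bounded , inverses
  where
  open AbelianGroup G using (_⁻¹; reflexive)
  open Sequences G
  open Pieces G

  bounded : ∀ k → k ∈L (U ++ V) → k ≤ length U × k ≤ length V
  bounded _ (As , refl , atoms , UV) =
    splitting-length≤ nzU nzV hyp (split As U V (atoms⇒blocks atoms) UV)

  inverses : IsMaxL (length U) (U ++ V) → 3 ≤ length U → ∀ g → g ∈ U → (g ⁻¹) ∈Σ V
  inverses ((As , |As|≡|U| , atoms , UV) , _) U≥3 g g∈U =
    splitting-inverses nzU nzV hyp (split As U V (atoms⇒blocks atoms) UV)
      |As|≡|U| U≥3 (Any.map reflexive g∈U)
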